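{- Let $\Delta$ be a $(d-1)$-dimensional boolean complex with nonnegative, symmetric $h$-vector $h=(h_0,\dots,h_d)$, $\gamma$-vector $\gamma=(\gamma_0,\dots,\gamma_{\lfloor d/2\rfloor})$, and $g$-vector $g=(g_0,\dots,g_{\lfloor d/2\rfloor})$. If $\gamma$ is the $f$-vector of a simplicial complex, then $g$ is the $f$-vector of a simplicial complex.
   Context: A boolean complex is a regular cell complex whose lower intervals $[\emptyset,F]$ in the face poset are boolean lattices. $f(\Delta;t)=\sum_Ft^{1+\dim F}$ (empty face included), $\sum_ih_it^i=(1-t)^df(\Delta;t/(1-t))$; symmetric means $h_i=h_{d-i}$, and then $\gamma$ is defined by $\sum_ih_it^i=\sum_{i=0}^{\lfloor d/2\rfloor}\gamma_it^i(1+t)^{d-2i}$. The $g$-vector is $g_0=h_0$ and $g_i=h_i-h_{i-1}$ for $1\le i\le\lfloor d/2\rfloor$. The $f$-vector of a simplicial complex is $(f_0,f_1,\dots)$ with $f_i$ the number of faces with $i$ vertices ($f_0=1$), trailing zeros allowed. -}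

module Defs where

open import Level using (0ℓ)
open import Data.Bool using (Bool; true; false)
open import Data.Nat as ℕ using (ℕ; zero; suc; _∸_; _≤_; _<_; _/_)
open import Data.Nat.Combinatorics using (_C_)
open import Data.Integer as ℤ using (ℤ; +_; -_; _-_)
open import Data.Fin using (Fin)
open import Data.Fin.Subset using (Subset; ⊥; _⊆_; ∣_∣)
open import Data.Vec using ([]; _∷_)
open import Data.List using (List; []; _∷_; _++_; map; allFin; length; filter)
open import Data.Product using (Σ; ∃; ∃-syntax; _×_; _,_)
open import Relation.Nullary using (Dec; yes; no)
open import Relation.Nullary.Decidable using (⌊_⌋)
open import Relation.Unary using (Pred)
open import Relation.Binary using (Rel; IsPartialOrder; Decidable)
open import Relation.Binary.PropositionalEquality using (_≡_)
open import Function.Bundles using (Inverse)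
import Relation.Binary.PropositionalEquality as P

sumTo : ℕ → (ℕ → ℤ) → ℤ
sumTo zero    a = a 0
sumTo (suc n) a = sumTo n a ℤ.+ a (suc n)

sign : ℕ → ℤ
sign zero    = + 1
sign (suc k) = - sign k

-- A boolean complex is represented by its (finite) face poset P on Fin N,
-- including the empty face ⊥̂ as least element, such that every lower
-- interval [⊥̂, x] is isomorphic (as a poset) to the boolean lattice of
-- subsets of a (rank x)-element set.  rank x = 1 + dim x.

Below : {N : ℕ} → Rel (Fin N) 0ℓ → Fin N → Set
Below _≼_ x = Σ (Fin _) (λ y → y ≼ x)

record BooleanComplex : Set₁ where
  field
    N              : ℕ
    _≼_            : Rel (Fin N) 0ℓ
    isPartialOrder : IsPartialOrder _≡_ _≼_
    _≼?_           : Decidable _≼_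
    bottom         : Fin N
    bottom-least   : ∀ x → bottom ≼ x
    rank           : Fin N → ℕ
    interval       : (x : Fin N) → Inverse (P.setoid (Below _≼_ x)) (P.setoid (Subset (rank x)))
    interval-order : (x : Fin N) (y z : Below _≼_ x) →
                     (Σ.proj₁ y ≼ Σ.proj₁ z) → Inverse.to (interval x) y ⊆ Inverse.to (interval x) z
    interval-order⁻ : (x : Fin N) (y z : Below _≼_ x) →
                     Inverse.to (interval x) y ⊆ Inverse.to (interval x) z → (Σ.proj₁ y ≼ Σ.proj₁ z)

open BooleanComplex public

HasDim-1 : BooleanComplex → ℕ → Set
HasDim-1 Δ d = (∀ x → rank Δ x ≤ d) × (∃[ x ] rank Δ x ≡ d)

-- f_i(Δ) = number of faces with rank i (i.e. dim i-1); f_0 = 1 (empty face)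
fB : BooleanComplex → ℕ → ℕ
fB Δ i = length (filter (λ x → rank Δ x ℕ.≟ i) (allFin (N Δ)))

-- h-vector, from  Σ h_i t^i = (1-t)^d f(Δ; t/(1-t)) = Σ_j f_j t^j (1-t)^(d-j):
--   h_i = Σ_{j=0}^{i} (-1)^(i-j) C(d-j, i-j) f_j
hB : BooleanComplex → ℕ → ℕ → ℤ
hB Δ d i = sumTo i (λ j → sign (i ∸ j) ℤ.* (+ ((d ∸ j) C (i ∸ j))) ℤ.* (+ fB Δ j))

Symmetric : ℕ → (ℕ → ℤ) → Set
Symmetric d h = ∀ i → i ≤ d → h i ≡ h (d ∸ i)

Nonnegative : ℕ → (ℕ → ℤ) → Set
Nonnegative d h = ∀ i → i ≤ d → + 0 ℤ.≤ h i

-- coefficient of t^i in t^j (1+t)^(d-2j)  (zero when i < j)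
gammaCoeff : ℕ → ℕ → ℕ → ℤ
gammaCoeff d i j with j ℕ.≤? i
... | yes _ = + ((d ∸ (2 ℕ.* j)) C (i ∸ j))
... | no  _ = + 0

IsGammaVector : ℕ → (ℕ → ℤ) → (ℕ → ℤ) → Set
IsGammaVector d h γ = ∀ i → i ≤ d → h i ≡ sumTo (d / 2) (λ j → γ j ℤ.* gammaCoeff d i j)

gVec : (ℕ → ℤ) → ℕ → ℤ
gVec h zero    = h 0
gVec h (suc i) = h (suc i) - h i

record SimplicialComplex (n : ℕ) : Set₁ where
  field
    IsFace   : Pred (Subset n) 0ℓ
    isFace?  : (s : Subset n) → Dec (IsFace s)
    empty    : IsFace ⊥
    downward : ∀ {s t} → s ⊆ t → IsFace t → IsFace s

open SimplicialComplex public

allSubsets : (n : ℕ) → List (Subset n)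
allSubsets zero    = [] ∷ []
allSubsets (suc n) = map (false ∷_) (allSubsets n) ++ map (true ∷_) (allSubsets n)

fS : {n : ℕ} → SimplicialComplex n → ℕ → ℕ
fS {n} K i = length (filter (λ s → ⌊ isFace? K s ⌋ Data.Bool.∧ ⌊ ∣ s ∣ ℕ.≟ i ⌋ Data.Bool.≟ true) (allSubsets n))

IsFVector : ℕ → (ℕ → ℤ) → Set₁
IsFVector m v = ∃[ n ] Σ (SimplicialComplex n) λ K →
  (∀ i → i ≤ m → + fS K i ≡ v i) × (∀ i → m < i → fS K i ≡ 0)

module Submission where

-- Let K be a simplicial complex with f-vector γ.  Join K with the vertex set {1, …, d}, keeping the sets
-- A ⊔ B with A a face of K and B a ballot set for j = ∣A∣: the r-th smallest element of B is at least
-- 2 (r + j).  Shrinking B or enlarging j preserves this, so the result is again a simplicial complex.  By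
-- Pascal's recursion there are C(d − 2j, k) − C(d − 2j, k − 1) ballot sets of size k when 2 (k + j) ≤ d,
-- and none of positive size when 2 (k + j) > d; this is the coefficient of t^(j + k) in the g-vector of
-- t^j (1 + t)^(d − 2j).  Counting faces by their part A, the f-vector of the join is
-- Σ_j γ_j g(t^j (1 + t)^(d − 2j)), which is g(Δ) since g is linear and h(Δ) = Σ_j γ_j t^j (1 + t)^(d − 2j).

open import Defs
import Algebra.Properties.Ring as RingProperties
import Algebra.Properties.CommutativeSemigroup as CommutativeSemigroupProperties
open import Data.Bool using (Bool; true; false; _∧_; T)
import Data.Bool as Bool
open import Data.Bool.Properties using (∧-zeroʳ; T-∧)
open import Data.Fin.Subset using (Subset; ∣_∣; _⊆_; ⊥)
open import Data.Fin.Subset.Properties using (drop-∷-⊆; p⊆q⇒∣p∣≤∣q∣; ∣p∣≤n)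
open import Data.Integer as ℤ using (ℤ; +_)
import Data.Integer.Properties as ℤP
open import Data.List using (List; []; _∷_; map; filter; length)
import Data.List as List
open import Data.List.Properties using (map-++; map-cong; map-∘)
open import Data.Nat using (ℕ; zero; suc; _+_; _*_; _∸_; _≤_; _<_; z≤n; s≤s; _≤ᵇ_; _/_)
open import Data.Nat.Properties
open import Data.Nat.Combinatorics using (_C_; nCk+nC[k+1]≡[n+1]C[k+1]; nCk≡nC[n∸k])
open import Data.Nat.DivMod using (m/n*n≤m; m*n/n≡m; /-monoˡ-≤)
open import Data.Nat.ListAction using (sum)
open import Data.Nat.ListAction.Properties using (sum-++)
open import Data.Product using (_×_; _,_; proj₂)
open import Data.Sum using (inj₁; inj₂)
open import Data.Vec using (_∷_; []; _++_; take; drop; here; there)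
open import Function.Bundles using (_⇔_; mk⇔; Equivalence)
open import Relation.Nullary using (Dec; yes; no; ¬_; contradiction; _×-dec_)
open import Relation.Nullary.Decidable using (⌊_⌋; T?; isYes≗does; does-⇔; dec-true; dec-false)
open import Relation.Binary.PropositionalEquality

open RingProperties ℤP.+-*-ring using (x[y-z]≈xy-xz)
open CommutativeSemigroupProperties +-commutativeSemigroup using () renaming (interchange to +-interchange)
open CommutativeSemigroupProperties ℤP.+-commutativeSemigroup using () renaming (interchange to ℤ+-interchange)

⌊⌋-true : ∀ {A : Set} (a? : Dec A) → A → ⌊ a? ⌋ ≡ true
⌊⌋-true a? a = trans (isYes≗does a?) (dec-true a? a)

⌊⌋-false : ∀ {A : Set} (a? : Dec A) → ¬ A → ⌊ a? ⌋ ≡ false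
⌊⌋-false a? ¬a = trans (isYes≗does a?) (dec-false a? ¬a)

⌊⌋-⇔ : ∀ {A B : Set} → A ⇔ B → (a? : Dec A) (b? : Dec B) → ⌊ a? ⌋ ≡ ⌊ b? ⌋
⌊⌋-⇔ A⇔B a? b? = trans (isYes≗does a?) (trans (does-⇔ A⇔B a? b?) (sym (isYes≗does b?)))

⌊×-dec⌋ : ∀ {A B : Set} (a? : Dec A) (b? : Dec B) → ⌊ a? ×-dec b? ⌋ ≡ ⌊ a? ⌋ ∧ ⌊ b? ⌋
⌊×-dec⌋ a? b? = trans (isYes≗does (a? ×-dec b?)) (sym (cong₂ _∧_ (isYes≗does a?) (isYes≗does b?)))

⌊T?⌋ : ∀ x → ⌊ T? x ⌋ ≡ x
⌊T?⌋ x = isYes≗does (T? x)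

≤ᵇ-true : ∀ {m n} → m ≤ n → (m ≤ᵇ n) ≡ true
≤ᵇ-true {m} {n} = dec-true (m ≤? n)

≤ᵇ-false : ∀ {m n} → ¬ m ≤ n → (m ≤ᵇ n) ≡ false
≤ᵇ-false {m} {n} = dec-false (m ≤? n)

𝟙 : Bool → ℕ
𝟙 true  = 1
𝟙 false = 0

𝟙-∧ : ∀ x y → 𝟙 (x ∧ y) ≡ 𝟙 x * 𝟙 y
𝟙-∧ true  y = sym (+-identityʳ (𝟙 y))
𝟙-∧ false y = refl

𝟙-∧-factor : ∀ x y z → 𝟙 ((x ∧ y) ∧ z) ≡ 𝟙 (y ∧ z) * 𝟙 x
𝟙-∧-factor true  y z = sym (*-identityʳ (𝟙 (y ∧ z)))
𝟙-∧-factor false y z = sym (*-zeroʳ (𝟙 (y ∧ z)))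

∑ : {A : Set} → List A → (A → ℕ) → ℕ
∑ xs f = sum (map f xs)

∑-cong : ∀ {A : Set} (xs : List A) {f g : A → ℕ} → (∀ a → f a ≡ g a) → ∑ xs f ≡ ∑ xs g
∑-cong xs f≗g = cong sum (map-cong f≗g xs)

∑-zero : ∀ {A : Set} (xs : List A) {f : A → ℕ} → (∀ a → f a ≡ 0) → ∑ xs f ≡ 0
∑-zero []       f≗0 = refl
∑-zero (x ∷ xs) f≗0 = cong₂ _+_ (f≗0 x) (∑-zero xs f≗0)

∑-++ : ∀ {A : Set} (xs ys : List A) f → ∑ (xs List.++ ys) f ≡ ∑ xs f + ∑ ys f
∑-++ xs ys f = trans (cong sum (map-++ f xs ys)) (sum-++ (map f xs) (map f ys))

∑-map : ∀ {A B : Set} (g : A → B) (xs : List A) f → ∑ (map g xs) f ≡ ∑ xs (λ a → f (g a))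
∑-map g xs f = cong sum (sym (map-∘ xs))

∑-*ʳ : ∀ {A : Set} (xs : List A) (f : A → ℕ) c → ∑ xs (λ a → f a * c) ≡ ∑ xs f * c
∑-*ʳ []       f c = refl
∑-*ʳ (x ∷ xs) f c = trans (cong (_+_ (f x * c)) (∑-*ʳ xs f c)) (sym (*-distribʳ-+ c (f x) _))

length-filter≡∑𝟙 : ∀ {A : Set} (p : A → Bool) xs →
  length (filter (λ a → p a Bool.≟ true) xs) ≡ ∑ xs (λ a → 𝟙 (p a))
length-filter≡∑𝟙 p []       = refl
length-filter≡∑𝟙 p (x ∷ xs) with p x
... | true  = cong suc (length-filter≡∑𝟙 p xs)
... | false = length-filter≡∑𝟙 p xs

∑ₛ : (n : ℕ) → (Subset n → ℕ) → ℕ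
∑ₛ n = ∑ (allSubsets n)

∑ₛ-suc : ∀ n f → ∑ₛ (suc n) f ≡ ∑ₛ n (λ s → f (false ∷ s)) + ∑ₛ n (λ s → f (true ∷ s))
∑ₛ-suc n f = trans (∑-++ (map (false ∷_) (allSubsets n)) _ f)
  (cong₂ _+_ (∑-map (false ∷_) (allSubsets n) f) (∑-map (true ∷_) (allSubsets n) f))

∑ₛ-++ : ∀ n d f → ∑ₛ (n + d) f ≡ ∑ₛ n (λ a → ∑ₛ d (λ b → f (a ++ b)))
∑ₛ-++ zero    d f = sym (+-identityʳ (∑ₛ d f))
∑ₛ-++ (suc n) d f = trans (∑ₛ-suc (n + d) f)
  (trans (cong₂ _+_ (∑ₛ-++ n d _) (∑ₛ-++ n d _)) (sym (∑ₛ-suc n _)))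

sumToℕ : ℕ → (ℕ → ℕ) → ℕ
sumToℕ zero    a = a 0
sumToℕ (suc n) a = sumToℕ n a + a (suc n)

+-sumToℕ : ∀ N f → + sumToℕ N f ≡ sumTo N (λ j → + f j)
+-sumToℕ zero    f = refl
+-sumToℕ (suc N) f = trans (ℤP.pos-+ (sumToℕ N f) (f (suc N))) (cong (ℤ._+ + f (suc N)) (+-sumToℕ N f))

sumToℕ-cong : ∀ N {f g} → (∀ j → f j ≡ g j) → sumToℕ N f ≡ sumToℕ N g
sumToℕ-cong zero    f≗g = f≗g 0
sumToℕ-cong (suc N) f≗g = cong₂ _+_ (sumToℕ-cong N f≗g) (f≗g (suc N))

sumToℕ-zero : ∀ N {f} → (∀ j → j ≤ N → f j ≡ 0) → sumToℕ N f ≡ 0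
sumToℕ-zero zero    f≗0 = f≗0 0 z≤n
sumToℕ-zero (suc N) f≗0 =
  cong₂ _+_ (sumToℕ-zero N (λ j j≤N → f≗0 j (m≤n⇒m≤1+n j≤N))) (f≗0 (suc N) ≤-refl)

sumToℕ-+ : ∀ N f g → sumToℕ N (λ j → f j + g j) ≡ sumToℕ N f + sumToℕ N g
sumToℕ-+ zero    f g = refl
sumToℕ-+ (suc N) f g = trans (cong (λ t → t + (f (suc N) + g (suc N))) (sumToℕ-+ N f g))
  (+-interchange (sumToℕ N f) (sumToℕ N g) (f (suc N)) (g (suc N)))

∑-sumToℕ : ∀ {A : Set} (xs : List A) N (G : A → ℕ → ℕ) →
  ∑ xs (λ a → sumToℕ N (G a)) ≡ sumToℕ N (λ j → ∑ xs (λ a → G a j))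
∑-sumToℕ []       N G = sym (sumToℕ-zero N (λ _ _ → refl))
∑-sumToℕ (x ∷ xs) N G = trans (cong (_+_ (sumToℕ N (G x))) (∑-sumToℕ xs N G)) (sym (sumToℕ-+ N (G x) _))

δ : ℕ → ℕ → ℕ
δ s j = 𝟙 ⌊ s ≟ j ⌋

*δ*-≢ : ∀ c {s j} h → s ≢ j → c * δ s j * h ≡ 0
*δ*-≢ c {s} {j} h s≢j = trans (cong (λ b → c * 𝟙 b * h) (⌊⌋-false (s ≟ j) s≢j)) (cong (_* h) (*-zeroʳ c))

*δ*-refl : ∀ c s h → c * δ s s * h ≡ c * h
*δ*-refl c s h = trans (cong (λ b → c * 𝟙 b * h) (⌊⌋-true (s ≟ s) refl)) (cong (_* h) (*-identityʳ c))

sumToℕ-δ-out : ∀ N {s} c (H : ℕ → ℕ) → N < s → sumToℕ N (λ j → c * δ s j * H j) ≡ 0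
sumToℕ-δ-out N c H N<s = sumToℕ-zero N λ j j≤N → *δ*-≢ c (H j) λ { refl → <⇒≱ N<s j≤N }

sumToℕ-δ : ∀ N {s} c (H : ℕ → ℕ) → s ≤ N → sumToℕ N (λ j → c * δ s j * H j) ≡ c * H s
sumToℕ-δ zero    c H z≤n = *δ*-refl c 0 (H 0)
sumToℕ-δ (suc N) c H s≤1+N with m≤n⇒m<n∨m≡n s≤1+N
... | inj₁ s<1+N = trans (cong₂ _+_ (sumToℕ-δ N c H (≤-pred s<1+N)) (*δ*-≢ c (H (suc N)) (<⇒≢ s<1+N)))
                         (+-identityʳ _)
... | inj₂ refl  = cong₂ _+_ (sumToℕ-δ-out N c H ≤-refl) (*δ*-refl c (suc N) (H (suc N)))

∑-by-size : ∀ {A : Set} (xs : List A) (w size : A → ℕ) (F : ℕ → ℕ) N → (∀ a → size a ≤ N) →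
  ∑ xs (λ a → w a * F (size a)) ≡ sumToℕ N (λ j → ∑ xs (λ a → w a * δ (size a) j) * F j)
∑-by-size xs w size F N size≤N = begin
  ∑ xs (λ a → w a * F (size a))
    ≡⟨ ∑-cong xs (λ a → sym (sumToℕ-δ N (w a) F (size≤N a))) ⟩
  ∑ xs (λ a → sumToℕ N (λ j → w a * δ (size a) j * F j))
    ≡⟨ ∑-sumToℕ xs N _ ⟩
  sumToℕ N (λ j → ∑ xs (λ a → w a * δ (size a) j * F j))
    ≡⟨ sumToℕ-cong N (λ j → ∑-*ʳ xs _ (F j)) ⟩
  sumToℕ N (λ j → ∑ xs (λ a → w a * δ (size a) j) * F j) ∎
  where open ≡-Reasoning

sumTo-cong : ∀ M {a b : ℕ → ℤ} → (∀ j → j ≤ M → a j ≡ b j) → sumTo M a ≡ sumTo M b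
sumTo-cong zero    a≗b = a≗b 0 z≤n
sumTo-cong (suc M) a≗b =
  cong₂ ℤ._+_ (sumTo-cong M (λ j j≤M → a≗b j (m≤n⇒m≤1+n j≤M))) (a≗b (suc M) ≤-refl)

sumTo-zero : ∀ M {a : ℕ → ℤ} → (∀ j → j ≤ M → a j ≡ + 0) → sumTo M a ≡ + 0
sumTo-zero zero    a≗0 = a≗0 0 z≤n
sumTo-zero (suc M) a≗0 =
  cong₂ ℤ._+_ (sumTo-zero M (λ j j≤M → a≗0 j (m≤n⇒m≤1+n j≤M))) (a≗0 (suc M) ≤-refl)

sumTo-truncate : ∀ M N (a : ℕ → ℤ) → M ≤ N → (∀ j → M < j → a j ≡ + 0) → sumTo N a ≡ sumTo M a
sumTo-truncate M zero    a z≤n   _   = refl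
sumTo-truncate M (suc N) a M≤1+N a≗0 with m≤n⇒m<n∨m≡n M≤1+N
... | inj₁ M<1+N = trans (cong₂ ℤ._+_ (sumTo-truncate M N a (≤-pred M<1+N) a≗0) (a≗0 (suc N) M<1+N))
                         (ℤP.+-identityʳ (sumTo M a))
... | inj₂ refl  = refl

sumTo-minus : ∀ M (a b : ℕ → ℤ) → sumTo M (λ j → a j ℤ.- b j) ≡ sumTo M a ℤ.- sumTo M b
sumTo-minus zero    a b = refl
sumTo-minus (suc M) a b = begin
  sumTo M (λ j → a j ℤ.- b j) ℤ.+ (a (suc M) ℤ.- b (suc M))
    ≡⟨ cong (ℤ._+ (a (suc M) ℤ.- b (suc M))) (sumTo-minus M a b) ⟩
  (A ℤ.- B) ℤ.+ (a (suc M) ℤ.- b (suc M))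
    ≡⟨ ℤ+-interchange A (ℤ.- B) (a (suc M)) (ℤ.- b (suc M)) ⟩
  (A ℤ.+ a (suc M)) ℤ.+ (ℤ.- B ℤ.+ ℤ.- b (suc M))
    ≡⟨ cong (ℤ._+_ (A ℤ.+ a (suc M))) (ℤP.neg-distrib-+ B (b (suc M))) ⟨
  (A ℤ.+ a (suc M)) ℤ.- (B ℤ.+ b (suc M)) ∎
  where
  open ≡-Reasoning
  A B : ℤ
  A = sumTo M a
  B = sumTo M b

gVec-cong : ∀ {h h′ : ℕ → ℤ} i → (∀ k → k ≤ i → h k ≡ h′ k) → gVec h i ≡ gVec h′ i
gVec-cong zero    h≗h′ = h≗h′ 0 z≤n
gVec-cong (suc i) h≗h′ = cong₂ ℤ._-_ (h≗h′ (suc i) ≤-refl) (h≗h′ i (n≤1+n i))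

gVec-sumTo : ∀ M (γ : ℕ → ℤ) (c : ℕ → ℕ → ℤ) i →
  gVec (λ i → sumTo M (λ j → γ j ℤ.* c i j)) i ≡ sumTo M (λ j → γ j ℤ.* gVec (λ i → c i j) i)
gVec-sumTo M γ c zero    = refl
gVec-sumTo M γ c (suc i) = begin
  sumTo M (λ j → γ j ℤ.* c (suc i) j) ℤ.- sumTo M (λ j → γ j ℤ.* c i j)
    ≡⟨ sumTo-minus M _ _ ⟨
  sumTo M (λ j → γ j ℤ.* c (suc i) j ℤ.- γ j ℤ.* c i j)
    ≡⟨ sumTo-cong M (λ j _ → x[y-z]≈xy-xz (γ j) (c (suc i) j) (c i j)) ⟨
  sumTo M (λ j → γ j ℤ.* (c (suc i) j ℤ.- c i j)) ∎
  where open ≡-Reasoning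

∣++∣ : ∀ {n d} (a : Subset n) (b : Subset d) → ∣ a ++ b ∣ ≡ ∣ a ∣ + ∣ b ∣
∣++∣ []          b = refl
∣++∣ (true ∷ a)  b = cong suc (∣++∣ a b)
∣++∣ (false ∷ a) b = ∣++∣ a b

take-++ : ∀ {n d} (a : Subset n) (b : Subset d) → take n (a ++ b) ≡ a
take-++ []      b = refl
take-++ (x ∷ a) b = cong (x ∷_) (take-++ a b)

drop-++ : ∀ {n d} (a : Subset n) (b : Subset d) → drop n (a ++ b) ≡ b
drop-++ []      b = refl
drop-++ (x ∷ a) b = drop-++ a b

take-⊥ : ∀ n {d} → take n (⊥ {n + d}) ≡ ⊥
take-⊥ zero    = refl
take-⊥ (suc n) = cong (false ∷_) (take-⊥ n)

drop-⊥ : ∀ n {d} → drop n (⊥ {n + d}) ≡ ⊥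
drop-⊥ zero    = refl
drop-⊥ (suc n) = drop-⊥ n

take-⊆ : ∀ n {d} {s t : Subset (n + d)} → s ⊆ t → take n s ⊆ take n t
take-⊆ (suc n) {s = x ∷ s} {y ∷ t} s⊆t here with s⊆t here
... | here = here
take-⊆ (suc n) {s = x ∷ s} {y ∷ t} s⊆t (there i∈s) = there (take-⊆ n (drop-∷-⊆ s⊆t) i∈s)

drop-⊆ : ∀ n {d} {s t : Subset (n + d)} → s ⊆ t → drop n s ⊆ drop n t
drop-⊆ zero    s⊆t = s⊆t
drop-⊆ (suc n) {s = x ∷ s} {y ∷ t} s⊆t = drop-⊆ n (drop-∷-⊆ s⊆t)

-- Entry 0 of b : Subset m stands for the number m, entry m ∸ 1 for the number 1.  Thus ballot j b
-- says that the r-th smallest element of b ⊆ {1, …, m} is at least 2 (r + j).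
ballot : ℕ → ∀ {m} → Subset m → Bool
ballot j []                 = true
ballot j (false ∷ b)        = ballot j b
ballot j {suc m} (true ∷ b) = (2 * suc ∣ b ∣ + 2 * j ≤ᵇ suc m) ∧ ballot j b

ballot-⊥ : ∀ j m → T (ballot j (⊥ {m}))
ballot-⊥ j zero    = _
ballot-⊥ j (suc m) = ballot-⊥ j m

ballot-antitone : ∀ {j j′ m} (s t : Subset m) → j ≤ j′ → s ⊆ t → T (ballot j′ t) → T (ballot j s)
ballot-antitone []          []          _    _   _  = _
ballot-antitone (false ∷ s) (false ∷ t) j≤j′ s⊆t ok = ballot-antitone s t j≤j′ (drop-∷-⊆ s⊆t) ok
ballot-antitone {j′ = j′} {suc m} (false ∷ s) (true ∷ t) j≤j′ s⊆t ok =
  ballot-antitone s t j≤j′ (drop-∷-⊆ s⊆t)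
    (proj₂ (Equivalence.to (T-∧ {2 * suc ∣ t ∣ + 2 * j′ ≤ᵇ suc m}) ok))
ballot-antitone (true ∷ s) (false ∷ t) _ s⊆t _ = contradiction (s⊆t here) λ ()
ballot-antitone {j} {j′} {suc m} (true ∷ s) (true ∷ t) j≤j′ s⊆t ok
  with room , rest ← Equivalence.to (T-∧ {2 * suc ∣ t ∣ + 2 * j′ ≤ᵇ suc m}) ok =
  Equivalence.from (T-∧ {2 * suc ∣ s ∣ + 2 * j ≤ᵇ suc m})
    (≤⇒≤ᵇ (≤-trans (+-mono-≤ (*-monoʳ-≤ 2 (s≤s ∣s∣≤∣t∣)) (*-monoʳ-≤ 2 j≤j′))
                   (≤ᵇ⇒≤ (2 * suc ∣ t ∣ + 2 * j′) (suc m) room))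
    , ballot-antitone s t j≤j′ (drop-∷-⊆ s⊆t) rest)
  where
  ∣s∣≤∣t∣ : ∣ s ∣ ≤ ∣ t ∣
  ∣s∣≤∣t∣ = p⊆q⇒∣p∣≤∣q∣ (drop-∷-⊆ s⊆t)

ballotJoin : ∀ {n} → SimplicialComplex n → (d : ℕ) → SimplicialComplex (n + d)
ballotJoin {n} K d = record
  { IsFace   = λ s → IsFace K (take n s) × T (ballot ∣ take n s ∣ (drop n s))
  ; isFace?  = λ s → isFace? K (take n s) ×-dec T? (ballot ∣ take n s ∣ (drop n s))
  ; empty    = subst (IsFace K) (sym (take-⊥ n)) (empty K)
             , subst₂ (λ a b → T (ballot ∣ a ∣ b)) (sym (take-⊥ n)) (sym (drop-⊥ n)) (ballot-⊥ _ d)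
  ; downward = λ s⊆t (face , ok) → downward K (take-⊆ n s⊆t) face
             , ballot-antitone _ _ (p⊆q⇒∣p∣≤∣q∣ (take-⊆ n s⊆t)) (drop-⊆ n s⊆t) ok
  }

ballotCount : ℕ → ℕ → ℕ → ℕ
ballotCount j m k = ∑ₛ m (λ b → 𝟙 (ballot j b ∧ ⌊ ∣ b ∣ ≟ k ⌋))

ballotCount-0 : ∀ j m → ballotCount j m 0 ≡ 1
ballotCount-0 j zero    = refl
ballotCount-0 j (suc m) = trans (∑ₛ-suc m _)
  (cong₂ _+_ (ballotCount-0 j m) (∑-zero (allSubsets m) (λ b → cong 𝟙 (∧-zeroʳ _))))

𝟙-∧-≟-suc : ∀ (c : ℕ → Bool) x k b →
  𝟙 ((c x ∧ b) ∧ ⌊ suc x ≟ suc k ⌋) ≡ 𝟙 (b ∧ ⌊ x ≟ k ⌋) * 𝟙 (c k)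
𝟙-∧-≟-suc c x k b with x ≟ k | suc x ≟ suc k
... | yes refl | yes _ with c x | b
...   | true  | true  = refl
...   | true  | false = refl
...   | false | true  = refl
...   | false | false = refl
𝟙-∧-≟-suc c x k b | no _ | no _ rewrite ∧-zeroʳ (c x ∧ b) | ∧-zeroʳ b = refl
𝟙-∧-≟-suc c x k b | yes x≡k | no 1+x≢1+k = contradiction (cong suc x≡k) 1+x≢1+k
𝟙-∧-≟-suc c x k b | no x≢k | yes 1+x≡1+k = contradiction (suc-injective 1+x≡1+k) x≢k

ballotCount-suc : ∀ j m k →
  ballotCount j (suc m) (suc k) ≡ ballotCount j m (suc k) + ballotCount j m k * 𝟙 (2 * suc k + 2 * j ≤ᵇ suc m)
ballotCount-suc j m k = trans (∑ₛ-suc m _) (cong (_+_ (ballotCount j m (suc k)))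
  (trans (∑-cong (allSubsets m) (λ b → 𝟙-∧-≟-suc (λ x → 2 * suc x + 2 * j ≤ᵇ suc m) ∣ b ∣ k (ballot j b)))
         (∑-*ʳ (allSubsets m) _ _)))

ballotCount-vanishes : ∀ j m k → 1 ≤ k → m < 2 * k + 2 * j → ballotCount j m k ≡ 0
ballotCount-vanishes j zero    (suc k) _ _ = refl
ballotCount-vanishes j (suc m) (suc k) _ m<2k+2j
  rewrite ballotCount-suc j m k | ≤ᵇ-false (<⇒≱ m<2k+2j) | *-zeroʳ (ballotCount j m k) =
  trans (+-identityʳ _) (ballotCount-vanishes j m (suc k) (s≤s z≤n) (<-trans (n<1+n m) m<2k+2j))

ballotCount-suc-≤ : ∀ j m k → 2 * suc k + 2 * j ≤ suc m →
  ballotCount j (suc m) (suc k) ≡ ballotCount j m (suc k) + ballotCount j m k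
ballotCount-suc-≤ j m k room
  rewrite ballotCount-suc j m k | ≤ᵇ-true room | *-identityʳ (ballotCount j m k) = refl

_C⁻_ : ℕ → ℕ → ℕ
m C⁻ zero  = 0
m C⁻ suc k = m C k

[1+m]Ck≡mCk+mC⁻k : ∀ m k → suc m C k ≡ m C k + m C⁻ k
[1+m]Ck≡mCk+mC⁻k m zero    = refl
[1+m]Ck≡mCk+mC⁻k m (suc k) = trans (sym (nCk+nC[k+1]≡[n+1]C[k+1] m k)) (+-comm (m C k) (m C suc k))

[1+2k]Ck≡[1+2k]C[1+k] : ∀ k → suc (2 * k) C k ≡ suc (2 * k) C suc k
[1+2k]Ck≡[1+2k]C[1+k] k = trans (nCk≡nC[n∸k] k≤1+2k) (cong (suc (2 * k) C_) 1+2k∸k≡1+k)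
  where
  k≤1+2k : k ≤ suc (2 * k)
  k≤1+2k = m≤n⇒m≤1+n (m≤m+n k (k + 0))
  1+2k∸k≡1+k : suc (2 * k) ∸ k ≡ suc k
  1+2k∸k≡1+k = trans (+-∸-assoc 1 (m≤m+n k (k + 0))) (cong suc (trans (m+n∸m≡n k (k + 0)) (+-identityʳ k)))

ballotCount-closed : ∀ j m k → 2 * k ≤ m → ballotCount j (m + 2 * j) k + m C⁻ k ≡ m C k
-- The closed form at size suc k, extended to the boundary m = 2k + 1 where the count vanishes and
-- m C k = m C suc k.
ballotCount-closed-suc : ∀ j m k → 2 * k < m → ballotCount j (m + 2 * j) (suc k) + m C k ≡ m C suc k

ballotCount-closed j m       zero    _      = cong (λ c → c + 0) (ballotCount-0 j (m + 2 * j))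
ballotCount-closed j (suc m) (suc k) 2k+2≤1+m = begin
  ballotCount j (suc m + 2 * j) (suc k) + suc m C⁻ suc k
    ≡⟨ cong₂ _+_ (ballotCount-suc-≤ j (m + 2 * j) k (+-monoˡ-≤ (2 * j) 2k+2≤1+m)) ([1+m]Ck≡mCk+mC⁻k m k) ⟩
  (ballotCount j (m + 2 * j) (suc k) + ballotCount j (m + 2 * j) k) + (m C k + m C⁻ k)
    ≡⟨ +-interchange (ballotCount j (m + 2 * j) (suc k)) _ (m C k) _ ⟩
  (ballotCount j (m + 2 * j) (suc k) + m C k) + (ballotCount j (m + 2 * j) k + m C⁻ k)
    ≡⟨ cong₂ _+_ (ballotCount-closed-suc j m k 2k<m) (ballotCount-closed j m k (<⇒≤ 2k<m)) ⟩
  m C suc k + m C k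
    ≡⟨ trans (+-comm (m C suc k) (m C k)) (nCk+nC[k+1]≡[n+1]C[k+1] m k) ⟩
  suc m C suc k ∎
  where
  open ≡-Reasoning
  2k<m : 2 * k < m
  2k<m = ≤-pred (subst (_≤ suc m) (*-suc 2 k) 2k+2≤1+m)

ballotCount-closed-suc j m k 2k<m with 2 * suc k ≤? m
... | yes 2k+2≤m = ballotCount-closed j m (suc k) 2k+2≤m
... | no  2k+2≰m with refl ← ≤-antisym (≤-pred (subst (suc m ≤_) (*-suc 2 k) (≰⇒> 2k+2≰m))) 2k<m =
  trans (cong (λ c → c + suc (2 * k) C k)
               (ballotCount-vanishes j (suc (2 * k) + 2 * j) (suc k) (s≤s z≤n) (+-monoˡ-< (2 * j) (≰⇒> 2k+2≰m))))
        ([1+2k]Ck≡[1+2k]C[1+k] k)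

m+n≡o⇒+m≡+o-+n : ∀ {a b c} → a + b ≡ c → + a ≡ + c ℤ.- + b
m+n≡o⇒+m≡+o-+n {a} {b} refl =
  sym (trans (ℤP.[+m]-[+n]≡m⊖n (a + b) b) (trans (ℤP.⊖-≥ (m≤n+m b a)) (cong +_ (m+n∸n≡m a b))))

ballotCount-closed-ℤ : ∀ j d k → 2 * k + 2 * j ≤ d →
  + ballotCount j d k ≡ + ((d ∸ 2 * j) C k) ℤ.- + ((d ∸ 2 * j) C⁻ k)
ballotCount-closed-ℤ j d k 2k+2j≤d = m+n≡o⇒+m≡+o-+n
  (subst (λ e → ballotCount j e k + (d ∸ 2 * j) C⁻ k ≡ (d ∸ 2 * j) C k)
         (m∸n+n≡m (m+n≤o⇒n≤o (2 * k) 2k+2j≤d))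
         (ballotCount-closed j (d ∸ 2 * j) k (m+n≤o⇒m≤o∸n (2 * k) 2k+2j≤d)))

gammaCoeff-≤ : ∀ {d i j} → j ≤ i → gammaCoeff d i j ≡ + ((d ∸ 2 * j) C (i ∸ j))
gammaCoeff-≤ {d} {i} {j} j≤i with j ≤? i
... | yes _   = refl
... | no  j≰i = contradiction j≤i j≰i

gammaCoeff-< : ∀ {d i j} → i < j → gammaCoeff d i j ≡ + 0
gammaCoeff-< {d} {i} {j} i<j with j ≤? i
... | yes j≤i = contradiction j≤i (<⇒≱ i<j)
... | no  _   = refl

gVec-gammaCoeff-< : ∀ {d i j} → i < j → gVec (λ i → gammaCoeff d i j) i ≡ + 0
gVec-gammaCoeff-< {d} {zero}  i<j = gammaCoeff-< {d} i<j
gVec-gammaCoeff-< {d} {suc i} i<j = cong₂ ℤ._-_ (gammaCoeff-< {d} i<j) (gammaCoeff-< {d} (<-trans (n<1+n i) i<j))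

gVec-gammaCoeff-≤ : ∀ {d i j} → j ≤ i →
  gVec (λ i → gammaCoeff d i j) i ≡ + ((d ∸ 2 * j) C (i ∸ j)) ℤ.- + ((d ∸ 2 * j) C⁻ (i ∸ j))
gVec-gammaCoeff-≤ {d} {zero}  z≤n = sym (ℤP.+-identityʳ (+ (d C 0)))
gVec-gammaCoeff-≤ {d} {suc i} {j} j≤1+i with m≤n⇒m<n∨m≡n j≤1+i
... | inj₁ (s≤s j≤i) = cong₂ ℤ._-_ (gammaCoeff-≤ {d} j≤1+i)
      (trans (gammaCoeff-≤ {d} j≤i) (cong (λ k → + ((d ∸ 2 * j) C⁻ k)) (sym (+-∸-assoc 1 j≤i))))
... | inj₂ refl = cong₂ ℤ._-_ (gammaCoeff-≤ {d} j≤1+i)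
      (trans (gammaCoeff-< {d} ≤-refl) (cong (λ k → + ((d ∸ 2 * j) C⁻ k)) (sym (n∸n≡0 i))))

2[n∸m]+2m≡2n : ∀ {m n} → m ≤ n → 2 * (n ∸ m) + 2 * m ≡ 2 * n
2[n∸m]+2m≡2n {m} {n} m≤n = trans (sym (*-distribˡ-+ 2 (n ∸ m) m)) (cong (2 *_) (m∸n+n≡m m≤n))

extensionCount : ℕ → ℕ → ℕ → ℕ
extensionCount d j i = ∑ₛ d (λ b → 𝟙 (ballot j b ∧ ⌊ j + ∣ b ∣ ≟ i ⌋))

extensionCount-≤ : ∀ d {j i} → j ≤ i → extensionCount d j i ≡ ballotCount j d (i ∸ j)
extensionCount-≤ d {j} {i} j≤i = ∑-cong (allSubsets d) λ b →
  cong (λ e → 𝟙 (ballot j b ∧ e)) (⌊⌋-⇔ (shift ∣ b ∣) (j + ∣ b ∣ ≟ i) (∣ b ∣ ≟ i ∸ j))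
  where
  shift : ∀ x → (j + x ≡ i) ⇔ (x ≡ i ∸ j)
  shift x = mk⇔ (λ e → trans (sym (m+n∸m≡n j x)) (cong (_∸ j) e))
                (λ e → trans (cong (_+_ j) e) (m+[n∸m]≡n j≤i))

extensionCount-< : ∀ d {j i} → i < j → extensionCount d j i ≡ 0
extensionCount-< d {j} {i} i<j = ∑-zero (allSubsets d) λ b →
  cong 𝟙 (trans (cong (ballot j b ∧_)
                      (⌊⌋-false (j + ∣ b ∣ ≟ i) λ e → <⇒≱ i<j (subst (j ≤_) e (m≤m+n j ∣ b ∣))))
                (∧-zeroʳ (ballot j b)))

extensionCount-vanishes : ∀ d {j i} → j < i → d < 2 * i → extensionCount d j i ≡ 0
extensionCount-vanishes d {j} {i} j<i d<2i = trans (extensionCount-≤ d (<⇒≤ j<i))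
  (ballotCount-vanishes j d (i ∸ j) (m<n⇒0<n∸m j<i) (subst (d <_) (sym (2[n∸m]+2m≡2n (<⇒≤ j<i))) d<2i))

extensionCount≡gVec-gammaCoeff : ∀ d {j i} → 2 * i ≤ d → + extensionCount d j i ≡ gVec (λ i → gammaCoeff d i j) i
extensionCount≡gVec-gammaCoeff d {j} {i} 2i≤d with j ≤? i
... | no  j≰i = trans (cong +_ (extensionCount-< d (≰⇒> j≰i))) (sym (gVec-gammaCoeff-< {d} (≰⇒> j≰i)))
... | yes j≤i = begin
  + extensionCount d j i                                       ≡⟨ cong +_ (extensionCount-≤ d j≤i) ⟩
  + ballotCount j d (i ∸ j)                                    ≡⟨ ballotCount-closed-ℤ j d (i ∸ j) 2[i∸j]+2j≤d ⟩
  + ((d ∸ 2 * j) C (i ∸ j)) ℤ.- + ((d ∸ 2 * j) C⁻ (i ∸ j))    ≡⟨ gVec-gammaCoeff-≤ {d} j≤i ⟨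
  gVec (λ i → gammaCoeff d i j) i                              ∎
  where
  open ≡-Reasoning
  2[i∸j]+2j≤d : 2 * (i ∸ j) + 2 * j ≤ d
  2[i∸j]+2j≤d = subst (_≤ d) (sym (2[n∸m]+2m≡2n j≤i)) 2i≤d

fS-as-∑ₛ : ∀ {n} (K : SimplicialComplex n) i → fS K i ≡ ∑ₛ n (λ a → 𝟙 ⌊ isFace? K a ⌋ * δ ∣ a ∣ i)
fS-as-∑ₛ {n} K i = trans (length-filter≡∑𝟙 (λ a → ⌊ isFace? K a ⌋ ∧ ⌊ ∣ a ∣ ≟ i ⌋) (allSubsets n))
                         (∑-cong (allSubsets n) λ a → 𝟙-∧ ⌊ isFace? K a ⌋ ⌊ ∣ a ∣ ≟ i ⌋)

fS-ballotJoin : ∀ {n} (K : SimplicialComplex n) d i N → n ≤ N →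
  fS (ballotJoin K d) i ≡ sumToℕ N (λ j → fS K j * extensionCount d j i)
fS-ballotJoin {n} K d i N n≤N = begin
  fS L i
    ≡⟨ length-filter≡∑𝟙 _ (allSubsets (n + d)) ⟩
  ∑ₛ (n + d) (λ s → 𝟙 (⌊ isFace? L s ⌋ ∧ ⌊ ∣ s ∣ ≟ i ⌋))
    ≡⟨ ∑ₛ-++ n d _ ⟩
  ∑ₛ n (λ a → ∑ₛ d (λ b → 𝟙 (⌊ isFace? L (a ++ b) ⌋ ∧ ⌊ ∣ a ++ b ∣ ≟ i ⌋)))
    ≡⟨ ∑-cong (allSubsets n) (λ a → trans (∑-cong (allSubsets d) (𝟙-face a)) (∑-*ʳ (allSubsets d) _ _)) ⟩
  ∑ₛ n (λ a → extensionCount d ∣ a ∣ i * 𝟙 ⌊ isFace? K a ⌋)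
    ≡⟨ ∑-cong (allSubsets n) (λ a → *-comm (extensionCount d ∣ a ∣ i) _) ⟩
  ∑ₛ n (λ a → 𝟙 ⌊ isFace? K a ⌋ * extensionCount d ∣ a ∣ i)
    ≡⟨ ∑-by-size (allSubsets n) (λ a → 𝟙 ⌊ isFace? K a ⌋) ∣_∣ (λ j → extensionCount d j i) N
                 (λ a → ≤-trans (∣p∣≤n a) n≤N) ⟩
  sumToℕ N (λ j → ∑ₛ n (λ a → 𝟙 ⌊ isFace? K a ⌋ * δ ∣ a ∣ j) * extensionCount d j i)
    ≡⟨ sumToℕ-cong N (λ j → cong (_* extensionCount d j i) (fS-as-∑ₛ K j)) ⟨
  sumToℕ N (λ j → fS K j * extensionCount d j i) ∎
  where
  open ≡-Reasoning
  L : SimplicialComplex (n + d)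
  L = ballotJoin K d
  ⌊isFace?⌋ : ∀ s → ⌊ isFace? L s ⌋ ≡ ⌊ isFace? K (take n s) ⌋ ∧ ballot ∣ take n s ∣ (drop n s)
  ⌊isFace?⌋ s = trans (⌊×-dec⌋ (isFace? K (take n s)) (T? _)) (cong (⌊ isFace? K (take n s) ⌋ ∧_) (⌊T?⌋ _))
  𝟙-face : ∀ a b → 𝟙 (⌊ isFace? L (a ++ b) ⌋ ∧ ⌊ ∣ a ++ b ∣ ≟ i ⌋)
                   ≡ 𝟙 (ballot ∣ a ∣ b ∧ ⌊ ∣ a ∣ + ∣ b ∣ ≟ i ⌋) * 𝟙 ⌊ isFace? K a ⌋
  𝟙-face a b = begin
    𝟙 (⌊ isFace? L (a ++ b) ⌋ ∧ ⌊ ∣ a ++ b ∣ ≟ i ⌋)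
      ≡⟨ cong₂ (λ u v → 𝟙 (u ∧ ⌊ v ≟ i ⌋)) (⌊isFace?⌋ (a ++ b)) (∣++∣ a b) ⟩
    𝟙 ((⌊ isFace? K (take n (a ++ b)) ⌋ ∧ ballot ∣ take n (a ++ b) ∣ (drop n (a ++ b))) ∧ ⌊ ∣ a ∣ + ∣ b ∣ ≟ i ⌋)
      ≡⟨ cong₂ (λ a′ b′ → 𝟙 ((⌊ isFace? K a′ ⌋ ∧ ballot ∣ a′ ∣ b′) ∧ ⌊ ∣ a ∣ + ∣ b ∣ ≟ i ⌋))
               (take-++ a b) (drop-++ a b) ⟩
    𝟙 ((⌊ isFace? K a ⌋ ∧ ballot ∣ a ∣ b) ∧ ⌊ ∣ a ∣ + ∣ b ∣ ≟ i ⌋)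
      ≡⟨ 𝟙-∧-factor ⌊ isFace? K a ⌋ (ballot ∣ a ∣ b) _ ⟩
    𝟙 (ballot ∣ a ∣ b ∧ ⌊ ∣ a ∣ + ∣ b ∣ ≟ i ⌋) * 𝟙 ⌊ isFace? K a ⌋ ∎

fS-ballotJoin-ℤ : ∀ {n} (K : SimplicialComplex n) d M (γ : ℕ → ℤ) →
  (∀ j → j ≤ M → + fS K j ≡ γ j) → (∀ j → M < j → fS K j ≡ 0) →
  ∀ i → + fS (ballotJoin K d) i ≡ sumTo M (λ j → γ j ℤ.* + extensionCount d j i)
fS-ballotJoin-ℤ {n} K d M γ fK≡γ fK≡0 i = begin
  + fS (ballotJoin K d) i
    ≡⟨ cong +_ (fS-ballotJoin K d i (n + M) (m≤m+n n M)) ⟩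
  + sumToℕ (n + M) (λ j → fS K j * extensionCount d j i)
    ≡⟨ +-sumToℕ (n + M) _ ⟩
  sumTo (n + M) (λ j → + (fS K j * extensionCount d j i))
    ≡⟨ sumTo-truncate M (n + M) _ (m≤n+m M n)
                      (λ j M<j → cong (λ f → + (f * extensionCount d j i)) (fK≡0 j M<j)) ⟩
  sumTo M (λ j → + (fS K j * extensionCount d j i))
    ≡⟨ sumTo-cong M (λ j j≤M → trans (ℤP.pos-* (fS K j) _)
                                     (cong (ℤ._* + extensionCount d j i) (fK≡γ j j≤M))) ⟩
  sumTo M (λ j → γ j ℤ.* + extensionCount d j i) ∎
  where open ≡-Reasoning

m≤n/2⇒2*m≤n : ∀ {m n} → m ≤ n / 2 → 2 * m ≤ n
m≤n/2⇒2*m≤n {m} {n} m≤n/2 = ≤-trans (*-monoʳ-≤ 2 m≤n/2) (subst (_≤ n) (*-comm (n / 2) 2) (m/n*n≤m n 2))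

n/2<m⇒n<2*m : ∀ {m n} → n / 2 < m → n < 2 * m
n/2<m⇒n<2*m {m} {n} n/2<m = ≰⇒> λ 2m≤n →
  <⇒≱ n/2<m (subst (_≤ n / 2) (m*n/n≡m m 2) (/-monoˡ-≤ 2 (subst (_≤ n) (*-comm 2 m) 2m≤n)))

proposition6p5 : (Δ : BooleanComplex) (d : ℕ) → HasDim-1 Δ d →
    Nonnegative d (hB Δ d) → Symmetric d (hB Δ d) →
    (γ : ℕ → ℤ) → IsGammaVector d (hB Δ d) γ →
    IsFVector (d / 2) γ → IsFVector (d / 2) (gVec (hB Δ d))
proposition6p5 Δ d _ _ _ γ h≡∑γ (n , K , fK≡γ , fK≡0) = n + d , ballotJoin K d , fL≡g , fL≡0
  where
  open ≡-Reasoning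
  fL : ∀ i → + fS (ballotJoin K d) i ≡ sumTo (d / 2) (λ j → γ j ℤ.* + extensionCount d j i)
  fL = fS-ballotJoin-ℤ K d (d / 2) γ fK≡γ fK≡0
  fL≡g : ∀ i → i ≤ d / 2 → + fS (ballotJoin K d) i ≡ gVec (hB Δ d) i
  fL≡g i i≤d/2 = begin
    + fS (ballotJoin K d) i
      ≡⟨ fL i ⟩
    sumTo (d / 2) (λ j → γ j ℤ.* + extensionCount d j i)
      ≡⟨ sumTo-cong (d / 2) (λ j _ → cong (γ j ℤ.*_) (extensionCount≡gVec-gammaCoeff d 2i≤d)) ⟩
    sumTo (d / 2) (λ j → γ j ℤ.* gVec (λ i → gammaCoeff d i j) i)
      ≡⟨ gVec-sumTo (d / 2) γ (gammaCoeff d) i ⟨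
    gVec (λ i → sumTo (d / 2) (λ j → γ j ℤ.* gammaCoeff d i j)) i
      ≡⟨ gVec-cong i (λ k k≤i → sym (h≡∑γ k (≤-trans k≤i (m+n≤o⇒m≤o i 2i≤d)))) ⟩
    gVec (hB Δ d) i ∎
    where
    2i≤d : 2 * i ≤ d
    2i≤d = m≤n/2⇒2*m≤n i≤d/2
  fL≡0 : ∀ i → d / 2 < i → fS (ballotJoin K d) i ≡ 0
  fL≡0 i d/2<i = ℤP.+-injective (trans (fL i) (sumTo-zero (d / 2) λ j j≤d/2 →
    trans (cong (λ e → γ j ℤ.* + e) (extensionCount-vanishes d (≤-<-trans j≤d/2 d/2<i) (n/2<m⇒n<2*m d/2<i)))
          (ℤP.*-zeroʳ (γ j))))
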